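{- Let $H$ be a graph with $k$ nodes. Any instance of $k$-sum with $n$ numbers per list can be reduced to a single instance of $\text{Exact- }H$ on $kn$ vertices (i.e., with $n$ vertices per super-node), which has a solution if and only if the $k$-sum instance has a solution.
   Context: $k$-sum: given $k$ lists $L_1,\dots,L_k$ of $n$ integers each, decide whether there exist $x_1\in L_1,\dots,x_k\in L_k$ with $\sum x_i=0$. Let $V(H)=\{h_1,\dots,h_k\}$. A complete $H$-partite graph has vertex set partitioned into super-nodes $P_{h_1},\dots,P_{h_k}$ of $n$ vertices each ($v_{i,j}$ the $j$-th vertex of $P_{h_i}$), with edge $(v_{i,a},v_{j,b})$ present iff $(h_i,h_j)\in E(H)$. An $H$-subgraph is a choice $\{v_{i,a_i}\}_{i\in[k]}$ of one vertex per super-node; with integer weights $w$ on vertices and edges its total weight is $\sum_i w(v_{i,a_i})+\sum_{(h_i,h_j)\in E(H)}w(v_{i,a_i},v_{j,a_j})$. $\text{Exact- }H$: given a complete $H$-partite graph with integer node and edge weights, decide whether some $H$-subgraph has total weight $0$. -}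

module Defs where

open import Data.Nat using (ℕ; zero; suc)
open import Data.Fin using (Fin; zero; suc; _<?_)
open import Data.Bool using (Bool; true; false; if_then_else_)
open import Data.Integer using (ℤ; _+_; 0ℤ)
open import Data.Product using (Σ; _×_)
open import Relation.Binary.PropositionalEquality using (_≡_)
open import Relation.Nullary using (¬_)
open import Relation.Nullary.Decidable using (⌊_⌋)
open import Data.Bool using (_∧_)

sumFin : (k : ℕ) → (Fin k → ℤ) → ℤ
sumFin zero    f = 0ℤ
sumFin (suc k) f = f zero + sumFin k (λ i → f (suc i))

record Graph (k : ℕ) : Set where
  field
    adj       : Fin k → Fin k → Bool
    symmetric : ∀ i j → adj i j ≡ adj j i
    loopless  : ∀ i → adj i i ≡ false
open Graph public

KSum : (k n : ℕ) → Set
KSum k n = Fin k → Fin n → ℤ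

KSumSolvable : {k n : ℕ} → KSum k n → Set
KSumSolvable {k} {n} L = Σ (Fin k → Fin n) λ a → sumFin k (λ i → L i (a i)) ≡ 0ℤ

-- Exact-H instance: the complete H-partite graph with super-nodes P_{h_i}
-- of n vertices each (v_{i,j} : Fin k × Fin n), with integer node weights and
-- integer weights on the edges (v_{i,a}, v_{j,b}) for (h_i,h_j) ∈ E(H).
-- Edge weights are given for all pairs but only those with (h_i,h_j) ∈ E(H)
-- (taken once per edge, i < j) ever enter the weight of an H-subgraph.
record ExactHInstance {k : ℕ} (H : Graph k) (n : ℕ) : Set where
  field
    nodeW : Fin k → Fin n → ℤ
    edgeW : Fin k → Fin n → Fin k → Fin n → ℤ
open ExactHInstance public

subgraphWeight : {k n : ℕ} {H : Graph k} → ExactHInstance H n → (Fin k → Fin n) → ℤ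
subgraphWeight {k} {n} {H} I a =
  sumFin k (λ i → nodeW I i (a i))
  + sumFin k (λ i → sumFin k (λ j →
      if ⌊ i <? j ⌋ ∧ adj H i j then edgeW I i (a i) j (a j) else 0ℤ))

ExactHSolvable : {k n : ℕ} {H : Graph k} → ExactHInstance H n → Set
ExactHSolvable {k} {n} I = Σ (Fin k → Fin n) λ a → subgraphWeight I a ≡ 0ℤ

-- Put the k lists on the node weights and make every edge weight 0: the weight
-- of the H-subgraph {v_{i, a i}} is then exactly Σ_i L_i(a_i), so the two
-- instances have the same solutions, whatever the graph H.
module Submission where

open import Defs
open import Data.Nat using (ℕ; zero; suc)
open import Data.Fin using (Fin; zero; suc)
open import Data.Bool using (if_then_else_)
open import Data.Bool.Properties using (if-eta)
open import Data.Integer using (ℤ; _+_; 0ℤ)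
open import Data.Integer.Properties using (+-identityʳ)
open import Data.Product using (Σ; _,_)
open import Function.Bundles using (_⇔_; mk⇔)
open import Relation.Binary.PropositionalEquality using (_≡_; refl; cong; cong₂; trans; sym; module ≡-Reasoning)

sumFin-zeros : (k : ℕ) (f : Fin k → ℤ) → (∀ i → f i ≡ 0ℤ) → sumFin k f ≡ 0ℤ
sumFin-zeros zero    f f≡0 = refl
sumFin-zeros (suc k) f f≡0 =
  cong₂ _+_ (f≡0 zero) (sumFin-zeros k (λ i → f (suc i)) (λ i → f≡0 (suc i)))

nodeWeighted : {k n : ℕ} {H : Graph k} → (Fin k → Fin n → ℤ) → ExactHInstance H n
nodeWeighted w = record { nodeW = w ; edgeW = λ _ _ _ _ → 0ℤ }

subgraphWeight-nodeWeighted : {k n : ℕ} (H : Graph k) (w : Fin k → Fin n → ℤ) (a : Fin k → Fin n) →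
  subgraphWeight (nodeWeighted {H = H} w) a ≡ sumFin k (λ i → w i (a i))
subgraphWeight-nodeWeighted {k} H w a = begin
  sumFin k (λ i → w i (a i)) + sumFin k (λ i → sumFin k (λ j → if _ then 0ℤ else 0ℤ))
    ≡⟨ cong (sumFin k (λ i → w i (a i)) +_) edgeSum≡0 ⟩
  sumFin k (λ i → w i (a i)) + 0ℤ
    ≡⟨ +-identityʳ _ ⟩
  sumFin k (λ i → w i (a i)) ∎
  where
  open ≡-Reasoning
  edgeSum≡0 : sumFin k (λ i → sumFin k (λ j → if _ then 0ℤ else 0ℤ)) ≡ 0ℤ
  edgeSum≡0 = sumFin-zeros k _ (λ i → sumFin-zeros k _ (λ j → if-eta _))

lemma3 : (k : ℕ) (H : Graph k) (n : ℕ) →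
    Σ (KSum k n → ExactHInstance H n) λ reduce →
      (L : KSum k n) → KSumSolvable L ⇔ ExactHSolvable (reduce L)
lemma3 k H n = nodeWeighted , λ L → mk⇔
  (λ { (a , sum≡0) → a , trans (subgraphWeight-nodeWeighted H L a) sum≡0 })
  (λ { (a , weight≡0) → a , trans (sym (subgraphWeight-nodeWeighted H L a)) weight≡0 })
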